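{- The following equivalences hold: \begin{enumerate} \item $(\phi \vee {\sf Most}^k_{\rm fun}\, g\, \psi) \equiv {\sf Most}^k_{\rm fun}\, g\,(\phi\vee \psi)$, if $g$ does not appear free in $\phi$, \item $(\phi \wedge {\sf Most}^k_{\rm fun}\, g\, \psi) \equiv {\sf Most}^k_{\rm fun}\, g\,(\phi\wedge \psi)$, if $g$ does not appear free in $\phi$. \end{enumerate}
   Context: All structures are finite. For $k\ge1$, the functional majority quantifier ${\sf Most}^k_{\rm fun}$ binds a $k$-ary function symbol $g$: for a structure ${\mathfrak A}$ with $|A|=n$, ${\mathfrak A}\models {\sf Most}^k_{\rm fun}\, g\,\phi(g)$ iff $|\{f\colon A^k\to A : {\mathfrak A}\models\phi(f)\}|\ge n^{n^k}/2$. The formulas are of ${\rm SO}({\sf Most}_{\rm fun})$, second-order logic extended with ${\sf Most}^k_{\rm fun}$ for all $k\ge1$. -}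

module Defs where

open import Data.Bool using (Bool; true; false; if_then_else_; _∧_; _∨_; not; T)
open import Data.Nat using (ℕ; zero; suc; _^_; _*_; _≤_; _≤ᵇ_; _≡ᵇ_)
open import Data.Nat.Properties using () renaming (_≟_ to _≟ℕ_)
open import Data.Fin using (Fin; zero; suc)
open import Data.Fin.Properties using () renaming (_≟_ to _≟F_)
open import Data.Vec using (Vec; []; _∷_)
open import Data.List using (List; []; _∷_; [_]; map; concatMap; allFin)
open import Data.Bool.ListAction using (any)
open import Data.Product using (_×_)
open import Relation.Nullary using (yes; no; does)
open import Relation.Binary.PropositionalEquality using (refl)

record Signature : Set₁ where
  field
    RelSym : Set
    relAr  : RelSym → ℕ
    FunSym : Set
    funAr  : FunSym → ℕ

open Signature public

-- Syntax of SO(Most_fun).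
-- First-order variables are named by ℕ; second-order relation variables
-- and function variables are named by a pair (arity k, name ℕ).

data Term (σ : Signature) : Set where
  var  : ℕ → Term σ
  app  : (f : FunSym σ) → Vec (Term σ) (funAr σ f) → Term σ
  fvar : (k g : ℕ) → Vec (Term σ) k → Term σ

data Formula (σ : Signature) : Set where
  rel   : (R : RelSym σ) → Vec (Term σ) (relAr σ R) → Formula σ
  rvar  : (k X : ℕ) → Vec (Term σ) k → Formula σ
  _≐_   : Term σ → Term σ → Formula σ
  ¬'_   : Formula σ → Formula σ
  _∨'_  : Formula σ → Formula σ → Formula σ
  _∧'_  : Formula σ → Formula σ → Formula σ
  ∃₁ ∀₁ : ℕ → Formula σ → Formula σ
  ∃R ∀R : (k X : ℕ) → Formula σ → Formula σ
  ∃F ∀F : (k g : ℕ) → Formula σ → Formula σ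
  Most  : (k : ℕ) → 1 ≤ k → (g : ℕ) → Formula σ → Formula σ

mutual
  occT : ∀ {σ} → ℕ → ℕ → Term σ → Bool
  occT k g (var x)         = false
  occT k g (app f ts)      = occTs k g ts
  occT k g (fvar k' g' ts) = ((k' ≡ᵇ k) ∧ (g' ≡ᵇ g)) ∨ occTs k g ts

  occTs : ∀ {σ} {m} → ℕ → ℕ → Vec (Term σ) m → Bool
  occTs k g []       = false
  occTs k g (t ∷ ts) = occT k g t ∨ occTs k g ts

freeF : ∀ {σ} → ℕ → ℕ → Formula σ → Bool
freeF k g (rel R ts)    = occTs k g ts
freeF k g (rvar _ _ ts) = occTs k g ts
freeF k g (t ≐ u)       = occT k g t ∨ occT k g u
freeF k g (¬' φ)        = freeF k g φ
freeF k g (φ ∨' ψ)      = freeF k g φ ∨ freeF k g ψ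
freeF k g (φ ∧' ψ)      = freeF k g φ ∨ freeF k g ψ
freeF k g (∃₁ x φ)      = freeF k g φ
freeF k g (∀₁ x φ)      = freeF k g φ
freeF k g (∃R _ _ φ)    = freeF k g φ
freeF k g (∀R _ _ φ)    = freeF k g φ
freeF k g (∃F k' g' φ)  = if (k' ≡ᵇ k) ∧ (g' ≡ᵇ g) then false else freeF k g φ
freeF k g (∀F k' g' φ)  = if (k' ≡ᵇ k) ∧ (g' ≡ᵇ g) then false else freeF k g φ
freeF k g (Most k' _ g' φ) = if (k' ≡ᵇ k) ∧ (g' ≡ᵇ g) then false else freeF k g φ

record Structure (σ : Signature) (n : ℕ) : Set where
  field
    relI : (R : RelSym σ) → Vec (Fin n) (relAr σ R) → Bool
    funI : (f : FunSym σ) → Vec (Fin n) (funAr σ f) → Fin n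

record Assignment (n : ℕ) : Set where
  field
    fo : ℕ → Fin n
    rv : (k : ℕ) → ℕ → Vec (Fin n) k → Bool
    fv : (k : ℕ) → ℕ → Vec (Fin n) k → Fin n

open Structure public
open Assignment public

updV : {B : ℕ → Set} (k X : ℕ) → B k → ((k' : ℕ) → ℕ → B k') → (k' : ℕ) → ℕ → B k'
updV k X v old k' X' with k' ≟ℕ k | X' ≟ℕ X
... | yes refl | yes _ = v
... | _        | _     = old k' X'

setFO : ∀ {n} → Assignment n → ℕ → Fin n → Assignment n
setFO ρ x a = record ρ { fo = λ y → if y ≡ᵇ x then a else fo ρ y }

setRV : ∀ {n} → Assignment n → (k X : ℕ) → (Vec (Fin n) k → Bool) → Assignment n
setRV {n} ρ k X r = record ρ { rv = updV {λ j → Vec (Fin n) j → Bool} k X r (rv ρ) }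

setFV : ∀ {n} → Assignment n → (k g : ℕ) → (Vec (Fin n) k → Fin n) → Assignment n
setFV {n} ρ k g f = record ρ { fv = updV {λ j → Vec (Fin n) j → Fin n} k g f (fv ρ) }

-- Enumeration of all functions (each exactly once, up to extensional
-- equality) from Fin n → C and from Vec (Fin n) k → B, given a list of
-- all elements of the codomain.

allFinFuns : {C : Set} (n : ℕ) → List C → List (Fin n → C)
allFinFuns zero    cs = [ (λ ()) ]
allFinFuns (suc n) cs =
  concatMap (λ c → map (λ h → λ { zero → c ; (suc i) → h i }) (allFinFuns n cs)) cs

allVecFuns : {B : Set} (n k : ℕ) → List B → List (Vec (Fin n) k → B)
allVecFuns n zero    bs = map (λ b → λ _ → b) bs
allVecFuns n (suc k) bs =
  map (λ h → λ { (x ∷ xs) → h x xs }) (allFinFuns n (allVecFuns n k bs))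

allFuns : (n k : ℕ) → List (Vec (Fin n) k → Fin n)
allFuns n k = allVecFuns n k (allFin n)

allRels : (n k : ℕ) → List (Vec (Fin n) k → Bool)
allRels n k = allVecFuns n k (true ∷ false ∷ [])

countB : {A : Set} → (A → Bool) → List A → ℕ
countB p []       = 0
countB p (x ∷ xs) = if p x then suc (countB p xs) else countB p xs

mutual
  evalT : ∀ {σ n} → Structure σ n → Assignment n → Term σ → Fin n
  evalT 𝔄 ρ (var x)        = fo ρ x
  evalT 𝔄 ρ (app f ts)     = funI 𝔄 f (evalTs 𝔄 ρ ts)
  evalT 𝔄 ρ (fvar k g ts)  = fv ρ k g (evalTs 𝔄 ρ ts)

  evalTs : ∀ {σ n m} → Structure σ n → Assignment n → Vec (Term σ) m → Vec (Fin n) m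
  evalTs 𝔄 ρ []       = []
  evalTs 𝔄 ρ (t ∷ ts) = evalT 𝔄 ρ t ∷ evalTs 𝔄 ρ ts

⟦_⟧ : ∀ {σ} → Formula σ → ∀ {n} → Structure σ n → Assignment n → Bool
⟦ rel R ts ⟧    𝔄 ρ = relI 𝔄 R (evalTs 𝔄 ρ ts)
⟦ rvar k X ts ⟧ 𝔄 ρ = rv ρ k X (evalTs 𝔄 ρ ts)
⟦ t ≐ u ⟧       𝔄 ρ = does (evalT 𝔄 ρ t ≟F evalT 𝔄 ρ u)
⟦ ¬' φ ⟧        𝔄 ρ = not (⟦ φ ⟧ 𝔄 ρ)
⟦ φ ∨' ψ ⟧      𝔄 ρ = ⟦ φ ⟧ 𝔄 ρ ∨ ⟦ ψ ⟧ 𝔄 ρ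
⟦ φ ∧' ψ ⟧      𝔄 ρ = ⟦ φ ⟧ 𝔄 ρ ∧ ⟦ ψ ⟧ 𝔄 ρ
⟦ ∃₁ x φ ⟧ {n = n} 𝔄 ρ = any (λ a → ⟦ φ ⟧ 𝔄 (setFO ρ x a)) (allFin n)
⟦ ∀₁ x φ ⟧ {n = n} 𝔄 ρ = not (any (λ a → not (⟦ φ ⟧ 𝔄 (setFO ρ x a))) (allFin n))
⟦ ∃R k X φ ⟧ {n = n} 𝔄 ρ = any (λ r → ⟦ φ ⟧ 𝔄 (setRV ρ k X r)) (allRels n k)
⟦ ∀R k X φ ⟧ {n = n} 𝔄 ρ = not (any (λ r → not (⟦ φ ⟧ 𝔄 (setRV ρ k X r))) (allRels n k))
⟦ ∃F k g φ ⟧ {n = n} 𝔄 ρ = any (λ f → ⟦ φ ⟧ 𝔄 (setFV ρ k g f)) (allFuns n k)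
⟦ ∀F k g φ ⟧ {n = n} 𝔄 ρ = not (any (λ f → not (⟦ φ ⟧ 𝔄 (setFV ρ k g f))) (allFuns n k))
-- |{f : A^k → A | 𝔄 ⊨ φ(f)}| ≥ n^(n^k) / 2, i.e. n^(n^k) ≤ 2·count
⟦ Most k _ g φ ⟧ {n = n} 𝔄 ρ =
  (n ^ (n ^ k)) ≤ᵇ (2 * countB (λ f → ⟦ φ ⟧ 𝔄 (setFV ρ k g f)) (allFuns n k))

_⊨_[_] : ∀ {σ n} → Structure σ n → Formula σ → Assignment n → Set
𝔄 ⊨ φ [ ρ ] = T (⟦ φ ⟧ 𝔄 ρ)

_≡ₗ_ : ∀ {σ} → Formula σ → Formula σ → Set
_≡ₗ_ {σ} φ ψ = ∀ {n} (𝔄 : Structure σ n) (ρ : Assignment n) →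
  (𝔄 ⊨ φ [ ρ ] → 𝔄 ⊨ ψ [ ρ ]) × (𝔄 ⊨ ψ [ ρ ] → 𝔄 ⊨ φ [ ρ ])

infix 4 _≡ₗ_

module Submission where

-- Idea.  Since g is not free in φ, the truth value b of φ does not change when
-- g is reinterpreted (coincidence lemma), so Most g (φ ∘ ψ), ∘ ∈ {∨, ∧}, counts the
-- functions f satisfying  b ∘ ψ(f).  For b = true the disjunction holds for
-- all n^(n^k) functions, which is at least half of them; for b = false the
-- conjunction holds for none, which is less than half because (as k ≥ 1)
-- there is at least one function.  In the remaining cases b ∘ ψ(f) is ψ(f).

open import Defs
open import Data.Nat using (ℕ; suc; _≤_; _^_; _*_; _+_; _≤ᵇ_; _≡ᵇ_; s≤s; z≤n)
open import Data.Nat.Properties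
  using (_≟_; ≡ᵇ⇒≡; ≡⇒≡ᵇ; ≤⇒≤ᵇ; m≤n*m; m^n>0; ^-*-assoc; *-comm; *-identityʳ)
open import Data.Bool using (Bool; true; false; T; not; _∧_; _∨_; if_then_else_)
open import Data.Bool.Properties using (T-∧; T-∨; T-≡; T-not-≡)
open import Data.Bool.ListAction using (any; or)
open import Data.Fin using (Fin)
open import Data.Fin.Properties using () renaming (_≟_ to _≟F_)
open import Data.Vec using (Vec; []; _∷_)
open import Data.List using (List; []; _∷_; length; concatMap; allFin)
open import Data.List.Properties using (length-map; length-++; length-tabulate; map-cong)
open import Data.Product using (_×_; _,_)
open import Data.Sum using (_⊎_; inj₁; inj₂)
open import Data.Empty using (⊥-elim)
open import Function using (Equivalence; _∘_; id)
open import Relation.Nullary using (yes; no; does)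
open import Relation.Binary.PropositionalEquality
  using (_≡_; _≢_; refl; sym; trans; cong; cong₂; subst; module ≡-Reasoning)

open Equivalence using (to; from)

any-cong : ∀ {A : Set} {p q : A → Bool} → (∀ a → p a ≡ q a) →
           ∀ xs → any p xs ≡ any q xs
any-cong e xs = cong or (map-cong e xs)

countB-cong : ∀ {A : Set} {p q : A → Bool} → (∀ a → p a ≡ q a) →
              ∀ xs → countB p xs ≡ countB q xs
countB-cong e []       = refl
countB-cong e (x ∷ xs) =
  cong₂ (λ b c → if b then suc c else c) (e x) (countB-cong e xs)

countB-true : ∀ {A : Set} (xs : List A) → countB (λ _ → true) xs ≡ length xs
countB-true []       = refl
countB-true (x ∷ xs) = cong suc (countB-true xs)

countB-false : ∀ {A : Set} (xs : List A) → countB (λ _ → false) xs ≡ 0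
countB-false []       = refl
countB-false (x ∷ xs) = countB-false xs

-- p holds for at least half of the N elements listed in xs; this is the
-- test in the semantics of Most, with N = n^(n^k) and xs = allFuns n k.
atLeastHalf : {A : Set} → ℕ → (A → Bool) → List A → Bool
atLeastHalf N p xs = N ≤ᵇ 2 * countB p xs

atLeastHalf-∨ : ∀ {A : Set} N (xs : List A) b (p : A → Bool) → N ≤ 2 * length xs →
                atLeastHalf N (λ x → b ∨ p x) xs ≡ b ∨ atLeastHalf N p xs
atLeastHalf-∨ N xs false p _   = refl
atLeastHalf-∨ N xs true  p N≤ = begin
  N ≤ᵇ 2 * countB (λ _ → true) xs  ≡⟨ cong (λ c → N ≤ᵇ 2 * c) (countB-true xs) ⟩
  N ≤ᵇ 2 * length xs               ≡⟨ to T-≡ (≤⇒≤ᵇ N≤) ⟩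
  true                             ∎
  where open ≡-Reasoning

atLeastHalf-∧ : ∀ {A : Set} N (xs : List A) b (p : A → Bool) → 1 ≤ N →
                atLeastHalf N (λ x → b ∧ p x) xs ≡ b ∧ atLeastHalf N p xs
atLeastHalf-∧ N       xs true  p _ = refl
atLeastHalf-∧ (suc N) xs false p _ = cong (λ c → suc N ≤ᵇ 2 * c) (countB-false xs)

length-concatMap : ∀ {A B : Set} (f : A → List B) m → (∀ a → length (f a) ≡ m) →
                   ∀ xs → length (concatMap f xs) ≡ length xs * m
length-concatMap f m e []       = refl
length-concatMap f m e (x ∷ xs) =
  trans (length-++ (f x)) (cong₂ _+_ (e x) (length-concatMap f m e xs))

length-allFinFuns : ∀ {C : Set} n (cs : List C) → length (allFinFuns n cs) ≡ length cs ^ n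
length-allFinFuns 0       cs = refl
length-allFinFuns (suc n) cs =
  length-concatMap _ (length cs ^ n)
    (λ c → trans (length-map _ (allFinFuns n cs)) (length-allFinFuns n cs)) cs

length-allVecFuns : ∀ {B : Set} n k (bs : List B) →
                    length (allVecFuns n k bs) ≡ length bs ^ (n ^ k)
length-allVecFuns n 0       bs = trans (length-map _ bs) (sym (*-identityʳ (length bs)))
length-allVecFuns n (suc k) bs = begin
  length (allVecFuns n (suc k) bs)      ≡⟨ length-map _ (allFinFuns n (allVecFuns n k bs)) ⟩
  length (allFinFuns n (allVecFuns n k bs)) ≡⟨ length-allFinFuns n (allVecFuns n k bs) ⟩
  length (allVecFuns n k bs) ^ n        ≡⟨ cong (_^ n) (length-allVecFuns n k bs) ⟩
  (length bs ^ (n ^ k)) ^ n             ≡⟨ ^-*-assoc (length bs) (n ^ k) n ⟩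
  length bs ^ (n ^ k * n)               ≡⟨ cong (length bs ^_) (*-comm (n ^ k) n) ⟩
  length bs ^ (n ^ suc k)               ∎
  where open ≡-Reasoning

length-allFuns : ∀ n k → length (allFuns n k) ≡ n ^ (n ^ k)
length-allFuns n k =
  trans (length-allVecFuns n k (allFin n)) (cong (_^ (n ^ k)) (length-tabulate id))

-- For k ≥ 1 there is at least one k-ary function, even on the empty domain.
allFuns-nonempty : ∀ n k → 1 ≤ k → 1 ≤ n ^ (n ^ k)
allFuns-nonempty 0       (suc k) _ = s≤s z≤n
allFuns-nonempty (suc n) k       _ = m^n>0 (suc n) (suc n ^ k)

same-var : ∀ k g → T ((k ≡ᵇ k) ∧ (g ≡ᵇ g))
same-var k g = from T-∧ (≡⇒≡ᵇ k k refl , ≡⇒≡ᵇ g g refl)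

distinct-var : ∀ {k g j h} → j ≢ k ⊎ h ≢ g → ((k ≡ᵇ j) ∧ (g ≡ᵇ h)) ≡ false
distinct-var {k} {g} {j} {h} d with (k ≡ᵇ j) ∧ (g ≡ᵇ h) in e
... | false = refl
... | true with to T-∧ (subst T (sym e) _) | d
...   | kj , gh | inj₁ j≢k = ⊥-elim (j≢k (sym (≡ᵇ⇒≡ k j kj)))
...   | kj , gh | inj₂ h≢g = ⊥-elim (h≢g (sym (≡ᵇ⇒≡ g h gh)))

-- A set of function variables, minus the variable (k , g) bound by a
-- quantifier; freeF of ∃F/∀F/Most k g φ is  removeVar k g (freeF · · φ).
removeVar : ℕ → ℕ → (ℕ → ℕ → Bool) → ℕ → ℕ → Bool
removeVar k g P j h = if (k ≡ᵇ j) ∧ (g ≡ᵇ h) then false else P j h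

removeVar-keeps : ∀ {k g j h} (P : ℕ → ℕ → Bool) → j ≢ k ⊎ h ≢ g →
                  T (P j h) → T (removeVar k g P j h)
removeVar-keeps {k} {g} {j} {h} P d p rewrite distinct-var {k} {g} {j} {h} d = p

∨-introˡ : ∀ {a b} → T a → T (a ∨ b)
∨-introˡ = from T-∨ ∘ inj₁

∨-introʳ : ∀ {a b} → T b → T (a ∨ b)
∨-introʳ = from T-∨ ∘ inj₂

module Coincidence {σ : Signature} {n : ℕ} (𝔄 : Structure σ n) where

  record AgreeOn (P : ℕ → ℕ → Bool) (ρ ρ' : Assignment n) : Set where
    field
      fo≗ : ∀ x → fo ρ x ≡ fo ρ' x
      rv≗ : ∀ j X v → rv ρ j X v ≡ rv ρ' j X v
      fv≗ : ∀ j h → T (P j h) → ∀ v → fv ρ j h v ≡ fv ρ' j h v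
  open AgreeOn

  restrict : ∀ {P Q : ℕ → ℕ → Bool} {ρ ρ'} → (∀ {j h} → T (Q j h) → T (P j h)) →
             AgreeOn P ρ ρ' → AgreeOn Q ρ ρ'
  restrict Q⊆P A = record
    { fo≗ = fo≗ A ; rv≗ = rv≗ A ; fv≗ = λ j h q → fv≗ A j h (Q⊆P q) }

  agreeˡ : ∀ {P Q : ℕ → ℕ → Bool} {ρ ρ'} → AgreeOn (λ j h → P j h ∨ Q j h) ρ ρ' → AgreeOn P ρ ρ'
  agreeˡ {P} {Q} = restrict (λ {j} {h} → ∨-introˡ {P j h} {Q j h})

  agreeʳ : ∀ {P Q : ℕ → ℕ → Bool} {ρ ρ'} → AgreeOn (λ j h → P j h ∨ Q j h) ρ ρ' → AgreeOn Q ρ ρ'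
  agreeʳ {P} {Q} = restrict (λ {j} {h} → ∨-introʳ {P j h} {Q j h})

  setFO-agree : ∀ {P ρ ρ'} x a → AgreeOn P ρ ρ' → AgreeOn P (setFO ρ x a) (setFO ρ' x a)
  setFO-agree {ρ = ρ} {ρ'} x a A = record { fo≗ = agree ; rv≗ = rv≗ A ; fv≗ = fv≗ A }
    where
      agree : ∀ y → (if y ≡ᵇ x then a else fo ρ y) ≡ (if y ≡ᵇ x then a else fo ρ' y)
      agree y with y ≡ᵇ x
      ... | true  = refl
      ... | false = fo≗ A y

  setRV-agree : ∀ {P ρ ρ'} k X r → AgreeOn P ρ ρ' → AgreeOn P (setRV ρ k X r) (setRV ρ' k X r)
  setRV-agree {ρ = ρ} {ρ'} k X r A = record { fo≗ = fo≗ A ; rv≗ = agree ; fv≗ = fv≗ A }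
    where
      agree : ∀ j Y v → updV {λ j → Vec (Fin n) j → Bool} k X r (rv ρ) j Y v
                      ≡ updV {λ j → Vec (Fin n) j → Bool} k X r (rv ρ') j Y v
      agree j Y v with j ≟ k | Y ≟ X
      ... | yes refl | yes _ = refl
      ... | yes refl | no _  = rv≗ A j Y v
      ... | no _     | _     = rv≗ A j Y v

  setFV-agree : ∀ {P ρ ρ'} k g f → AgreeOn (removeVar k g P) ρ ρ' →
                AgreeOn P (setFV ρ k g f) (setFV ρ' k g f)
  setFV-agree {P} {ρ} {ρ'} k g f A = record { fo≗ = fo≗ A ; rv≗ = rv≗ A ; fv≗ = agree }
    where
      agree : ∀ j h → T (P j h) → ∀ v →
              updV {λ j → Vec (Fin n) j → Fin n} k g f (fv ρ) j h v
              ≡ updV {λ j → Vec (Fin n) j → Fin n} k g f (fv ρ') j h v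
      agree j h p v with j ≟ k | h ≟ g
      ... | yes refl | yes refl = refl
      ... | yes refl | no h≢g   = fv≗ A j h (removeVar-keeps {k} {g} P (inj₂ h≢g) p) v
      ... | no j≢k   | _        = fv≗ A j h (removeVar-keeps {k} {g} P (inj₁ j≢k) p) v

  mutual
    evalT-coincide : ∀ {ρ ρ'} (t : Term σ) → AgreeOn (λ j h → occT j h t) ρ ρ' →
                     evalT 𝔄 ρ t ≡ evalT 𝔄 ρ' t
    evalT-coincide (var x)       A = fo≗ A x
    evalT-coincide (app f ts)    A = cong (funI 𝔄 f) (evalTs-coincide ts A)
    evalT-coincide {ρ} {ρ'} (fvar k g ts) A = begin
      fv ρ  k g (evalTs 𝔄 ρ ts)  ≡⟨ cong (fv ρ k g) (evalTs-coincide ts (agreeʳ A)) ⟩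
      fv ρ  k g (evalTs 𝔄 ρ' ts) ≡⟨ fv≗ A k g (∨-introˡ (same-var k g)) _ ⟩
      fv ρ' k g (evalTs 𝔄 ρ' ts) ∎
      where open ≡-Reasoning

    evalTs-coincide : ∀ {m ρ ρ'} (ts : Vec (Term σ) m) → AgreeOn (λ j h → occTs j h ts) ρ ρ' →
                      evalTs 𝔄 ρ ts ≡ evalTs 𝔄 ρ' ts
    evalTs-coincide []       A = refl
    evalTs-coincide (t ∷ ts) A =
      cong₂ _∷_ (evalT-coincide t (agreeˡ A)) (evalTs-coincide ts (agreeʳ A))

  coincidence : ∀ (φ : Formula σ) {ρ ρ'} → AgreeOn (λ j h → freeF j h φ) ρ ρ' →
                ⟦ φ ⟧ 𝔄 ρ ≡ ⟦ φ ⟧ 𝔄 ρ'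
  coincidence (rel R ts)    A = cong (relI 𝔄 R) (evalTs-coincide ts A)
  coincidence (rvar k X ts) {ρ} A =
    trans (cong (rv ρ k X) (evalTs-coincide ts A)) (rv≗ A k X _)
  coincidence (t ≐ u)       A =
    cong₂ (λ a b → does (a ≟F b))
          (evalT-coincide t (agreeˡ A)) (evalT-coincide u (agreeʳ A))
  coincidence (¬' φ)        A = cong not (coincidence φ A)
  coincidence (φ ∨' ψ)      A =
    cong₂ _∨_ (coincidence φ (agreeˡ A)) (coincidence ψ (agreeʳ A))
  coincidence (φ ∧' ψ)      A =
    cong₂ _∧_ (coincidence φ (agreeˡ A)) (coincidence ψ (agreeʳ A))
  coincidence (∃₁ x φ)      A =
    any-cong (λ a → coincidence φ (setFO-agree x a A)) (allFin n)
  coincidence (∀₁ x φ)      A =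
    cong not (any-cong (λ a → cong not (coincidence φ (setFO-agree x a A))) (allFin n))
  coincidence (∃R k X φ)    A =
    any-cong (λ r → coincidence φ (setRV-agree k X r A)) (allRels n k)
  coincidence (∀R k X φ)    A =
    cong not (any-cong (λ r → cong not (coincidence φ (setRV-agree k X r A))) (allRels n k))
  coincidence (∃F k g φ)    A =
    any-cong (λ f → coincidence φ (setFV-agree k g f A)) (allFuns n k)
  coincidence (∀F k g φ)    A =
    cong not (any-cong (λ f → cong not (coincidence φ (setFV-agree k g f A))) (allFuns n k))
  coincidence (Most k _ g φ) A =
    cong (λ c → n ^ (n ^ k) ≤ᵇ 2 * c)
         (countB-cong (λ f → coincidence φ (setFV-agree k g f A)) (allFuns n k))

  setFV-unused : ∀ (φ : Formula σ) ρ k g f → T (not (freeF k g φ)) →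
                 ⟦ φ ⟧ 𝔄 (setFV ρ k g f) ≡ ⟦ φ ⟧ 𝔄 ρ
  setFV-unused φ ρ k g f nf =
    coincidence φ (record { fo≗ = λ _ → refl ; rv≗ = λ _ _ _ → refl ; fv≗ = agree })
    where
      agree : ∀ j h → T (freeF j h φ) → ∀ v →
              updV {λ j → Vec (Fin n) j → Fin n} k g f (fv ρ) j h v ≡ fv ρ j h v
      agree j h p v with j ≟ k | h ≟ g
      ... | yes refl | yes refl = ⊥-elim (subst T (to T-not-≡ nf) p)
      ... | yes refl | no _     = refl
      ... | no _     | _        = refl

semantic-≡ₗ : ∀ {σ} (φ ψ : Formula σ) →
              (∀ {n} (𝔄 : Structure σ n) ρ → ⟦ φ ⟧ 𝔄 ρ ≡ ⟦ ψ ⟧ 𝔄 ρ) → φ ≡ₗ ψ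
semantic-≡ₗ φ ψ e 𝔄 ρ = subst T (e 𝔄 ρ) , subst T (sym (e 𝔄 ρ))

module Distribution {σ : Signature} {n : ℕ} (𝔄 : Structure σ n) (ρ : Assignment n)
                    (k : ℕ) (k≥1 : 1 ≤ k) (g : ℕ) (φ ψ : Formula σ)
                    (g∉φ : T (not (freeF k g φ))) where
  open Coincidence 𝔄

  N : ℕ
  N = n ^ (n ^ k)

  b : Bool
  b = ⟦ φ ⟧ 𝔄 ρ

  ψ[_] : (Vec (Fin n) k → Fin n) → Bool
  ψ[ f ] = ⟦ ψ ⟧ 𝔄 (setFV ρ k g f)

  count-constant : ∀ (_∙_ : Bool → Bool → Bool) →
                   countB (λ f → ⟦ φ ⟧ 𝔄 (setFV ρ k g f) ∙ ψ[ f ]) (allFuns n k)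
                   ≡ countB (λ f → b ∙ ψ[ f ]) (allFuns n k)
  count-constant _∙_ =
    countB-cong (λ f → cong (_∙ ψ[ f ]) (setFV-unused φ ρ k g f g∉φ)) (allFuns n k)

  -- Most g (φ ∨ ψ): if φ holds, all N functions qualify, which is at least half.
  Most-∨ : ⟦ φ ∨' Most k k≥1 g ψ ⟧ 𝔄 ρ ≡ ⟦ Most k k≥1 g (φ ∨' ψ) ⟧ 𝔄 ρ
  Most-∨ = begin
    b ∨ atLeastHalf N ψ[_] (allFuns n k)
      ≡⟨ sym (atLeastHalf-∨ N (allFuns n k) b ψ[_] N≤2N) ⟩
    atLeastHalf N (λ f → b ∨ ψ[ f ]) (allFuns n k)
      ≡⟨ cong (λ c → N ≤ᵇ 2 * c) (sym (count-constant _∨_)) ⟩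
    ⟦ Most k k≥1 g (φ ∨' ψ) ⟧ 𝔄 ρ
      ∎
    where
      open ≡-Reasoning
      N≤2N : N ≤ 2 * length (allFuns n k)
      N≤2N = subst (λ m → N ≤ 2 * m) (sym (length-allFuns n k)) (m≤n*m N 2)

  -- Most g (φ ∧ ψ): if φ fails, no function qualifies, and N ≥ 1 as k ≥ 1.
  Most-∧ : ⟦ φ ∧' Most k k≥1 g ψ ⟧ 𝔄 ρ ≡ ⟦ Most k k≥1 g (φ ∧' ψ) ⟧ 𝔄 ρ
  Most-∧ = begin
    b ∧ atLeastHalf N ψ[_] (allFuns n k)
      ≡⟨ sym (atLeastHalf-∧ N (allFuns n k) b ψ[_] (allFuns-nonempty n k k≥1)) ⟩
    atLeastHalf N (λ f → b ∧ ψ[ f ]) (allFuns n k)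
      ≡⟨ cong (λ c → N ≤ᵇ 2 * c) (sym (count-constant _∧_)) ⟩
    ⟦ Most k k≥1 g (φ ∧' ψ) ⟧ 𝔄 ρ
      ∎
    where open ≡-Reasoning

proposition3p2 : (σ : Signature) (k : ℕ) (k≥1 : 1 ≤ k) (g : ℕ) (φ ψ : Formula σ) →
    T (not (freeF k g φ)) →
      ((φ ∨' Most k k≥1 g ψ) ≡ₗ Most k k≥1 g (φ ∨' ψ))
      × ((φ ∧' Most k k≥1 g ψ) ≡ₗ Most k k≥1 g (φ ∧' ψ))
proposition3p2 σ k k≥1 g φ ψ g∉φ =
    semantic-≡ₗ (φ ∨' Most k k≥1 g ψ) (Most k k≥1 g (φ ∨' ψ))
                (λ 𝔄 ρ → Distribution.Most-∨ 𝔄 ρ k k≥1 g φ ψ g∉φ)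
  , semantic-≡ₗ (φ ∧' Most k k≥1 g ψ) (Most k k≥1 g (φ ∧' ψ))
                (λ 𝔄 ρ → Distribution.Most-∧ 𝔄 ρ k k≥1 g φ ψ g∉φ)
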